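{- Let $G$ be a graph and let $D\subseteq V(G)$ be a dominating set of $G$ of cardinality $\gamma(G)$. Then $b_2(G)\le\gamma(G)+b_1(G-D)$.
   Context: Throughout, graphs are finite and $G$ is connected. A set $D\subseteq V(G)$ is dominating if every vertex is in $D$ or has a neighbor in $D$; $\gamma(G)$ is the minimum cardinality of a dominating set. $G-D$ is the subgraph induced by $V(G)\setminus D$. For $r\in\{1,2\}$, the $r$-burning process: given a graph $G$ and a sequence $s=(s_1,\dots,s_k)$ of vertices (sources), at round $0$ all vertices are uncolored; at each round $j\ge1$, (i) if $j\le k$ and $s_j$ is uncolored, $s_j$ is colored blue, and (ii) every uncolored vertex having at least $r$ neighbors that were blue at the end of round $j-1$ is colored blue. $s$ is an $r$-burning sequence if eventually all vertices are blue; $\mathrm{rd}(s)$ is the first round at the end of which all vertices are blue. $b_r(G)$ is the minimum of $\mathrm{rd}(s)$ over all $r$-burning sequences for $G$ ($b_1$ is the usual burning number). -}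

module Defs where

open import Data.Nat using (ℕ; zero; suc; _+_; _≤_; _<_; _≤ᵇ_)
open import Data.Bool using (Bool; true; false; _∧_; _∨_; not; if_then_else_)
open import Data.Fin using (Fin; _≟_)
open import Data.Fin.Subset using (Subset; _∈_; ∣_∣)
open import Data.List using (List; []; _∷_; length; map; allFin; filterᵇ; lookup)
open import Data.Nat.ListAction using (sum)
open import Data.Vec using () renaming (lookup to vlookup)
open import Data.Maybe using (Maybe; just; nothing)
open import Data.Product using (Σ; _×_; ∃)
open import Data.Sum using (_⊎_)
open import Relation.Nullary using (¬_; does)
open import Relation.Binary.PropositionalEquality using (_≡_)

record Graph : Set where
  field
    n      : ℕ
    adj    : Fin n → Fin n → Bool
    sym    : ∀ u v → adj u v ≡ adj v u
    irrefl : ∀ v → adj v v ≡ false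
open Graph public

data Reach (G : Graph) : Fin (n G) → Fin (n G) → Set where
  here : ∀ {v} → Reach G v v
  step : ∀ {u w v} → adj G u w ≡ true → Reach G w v → Reach G u v

Connected : Graph → Set
Connected G = ∀ u v → Reach G u v

Dominating : (G : Graph) → Subset (n G) → Set
Dominating G D = ∀ v → v ∈ D ⊎ Σ (Fin (n G)) (λ u → u ∈ D × adj G v u ≡ true)

IsDominationNumber : Graph → ℕ → Set
IsDominationNumber G g =
  Σ (Subset (n G)) (λ D → Dominating G D × ∣ D ∣ ≡ g)
  × (∀ D → Dominating G D → g ≤ ∣ D ∣)

-- Induced subgraph G - D: vertices of G not in D, in increasing order,
-- re-indexed by Fin m.
verticesOutside : (G : Graph) → Subset (n G) → List (Fin (n G))
verticesOutside G D = filterᵇ (λ v → not (vlookup D v)) (allFin (n G))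

_─_ : (G : Graph) → Subset (n G) → Graph
G ─ D = record
  { n      = length vs
  ; adj    = λ i j → adj G (lookup vs i) (lookup vs j)
  ; sym    = λ i j → sym G (lookup vs i) (lookup vs j)
  ; irrefl = λ i → irrefl G (lookup vs i)
  }
  where vs = verticesOutside G D

nth : {A : Set} → List A → ℕ → Maybe A
nth []       _       = nothing
nth (x ∷ xs) zero    = just x
nth (x ∷ xs) (suc k) = nth xs k

isSource : {k : ℕ} → Maybe (Fin k) → Fin k → Bool
isSource nothing  v = false
isSource (just s) v = does (s ≟ v)

blue : ℕ → (G : Graph) → List (Fin (n G)) → ℕ → Fin (n G) → Bool
blueNbrs : ℕ → (G : Graph) → List (Fin (n G)) → ℕ → Fin (n G) → ℕ

blue r G s zero    v = false
-- round suc j: source s_{j+1} (list index j) is coloured, and every vertex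
-- with ≥ r neighbours blue at the end of round j is coloured.
blue r G s (suc j) v =
  blue r G s j v ∨ isSource (nth s j) v ∨ (r ≤ᵇ blueNbrs r G s j v)

blueNbrs r G s j v =
  sum (map (λ u → if adj G v u ∧ blue r G s j u then 1 else 0) (allFin (n G)))

AllBlue : ℕ → (G : Graph) → List (Fin (n G)) → ℕ → Set
AllBlue r G s j = ∀ v → blue r G s j v ≡ true

Rd : ℕ → (G : Graph) → List (Fin (n G)) → ℕ → Set
Rd r G s t = AllBlue r G s t × (∀ j → j < t → ¬ AllBlue r G s j)

IsBurningNumber : ℕ → Graph → ℕ → Set
IsBurningNumber r G b =
  Σ (List (Fin (n G))) (λ s → Rd r G s b)
  × (∀ s t → Rd r G s t → b ≤ t)

{-# OPTIONS --safe #-}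
-- Burn the vertices of D first, one per round, and then replay an optimal
-- 1-burning sequence of G − D.  After |D| rounds all of D is blue, and every
-- vertex outside D has a neighbour in D; so a vertex of G − D with one blue
-- neighbour in G − D has two blue neighbours in G.  Hence every vertex that is
-- blue after round j of the 1-burning process on G − D is blue after round
-- |D| + j of the 2-burning process on G.
module Submission where

open import Defs hiding (sym)
open import Data.Bool using (Bool; true; false; _∧_; _∨_; not; if_then_else_; T)
open import Data.Bool.Properties using (∨-zeroʳ; ∧-conicalˡ; ∧-conicalʳ; T-≡)
import Data.Bool.Properties as Bool
open import Data.Empty using (⊥-elim)
open import Data.Fin using (Fin; zero; suc; _≟_)
open import Data.Fin.Properties using (all?)
open import Data.Fin.Subset using (Subset; inside; outside; _∈_; _∉_; ∣_∣)
open import Data.List using (List; []; _∷_; _++_; length; map; allFin; lookup)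
open import Data.List.Membership.Propositional using () renaming (_∈_ to _∈ₗ_)
open import Data.List.Membership.Propositional.Properties
  using (∈-map⁺; ∈-filter⁺; ∈-filter⁻; ∈-lookup; ∈-allFin)
open import Data.List.Properties using (length-map; map-tabulate)
open import Data.List.Relation.Unary.Any using (here; there; index)
open import Data.List.Relation.Unary.Any.Properties using (lookup-index)
open import Data.Maybe using (just; nothing)
import Data.Maybe as Maybe
open import Data.Nat using (ℕ; zero; suc; _+_; _≤_; _<_; _≤′_; ≤′-refl; ≤′-step; _≤ᵇ_; z≤n; s≤s)
open import Data.Nat.ListAction using (sum)
open import Data.Nat.Properties
  using (≤-trans; ≤-refl; ≤-pred; m≤n+m; m≤m+n; m≤n⇒m≤1+n; +-suc; ≤⇒≤′; ≤⇒≤ᵇ; ≤ᵇ⇒≤)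
open import Data.Product using (∃; _×_; _,_; proj₂)
open import Data.Sum using (_⊎_; inj₁; inj₂)
open import Data.Unit using (tt)
open import Data.Vec using ([]; _∷_; here; there) renaming (lookup to vlookup)
open import Data.Vec.Properties using ([]=⇒lookup; lookup⇒[]=)
open import Function using (_∘_)
open import Function.Bundles using (Equivalence)
open import Relation.Nullary using (¬_; yes; no)
open import Relation.Nullary.Decidable using (dec-true; T?)
open import Relation.Binary.PropositionalEquality
  using (_≡_; refl; sym; trans; cong; cong₂; subst; module ≡-Reasoning)

open Equivalence using (to; from)

nth-++ˡ : ∀ {A : Set} (xs ys : List A) {k} → k < length xs → nth (xs ++ ys) k ≡ nth xs k
nth-++ˡ (_ ∷ xs) ys {zero}  _        = refl
nth-++ˡ (_ ∷ xs) ys {suc k} (s≤s k<) = nth-++ˡ xs ys k<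

nth-++ʳ : ∀ {A : Set} (xs ys : List A) k → nth (xs ++ ys) (length xs + k) ≡ nth ys k
nth-++ʳ []       ys k = refl
nth-++ʳ (_ ∷ xs) ys k = nth-++ʳ xs ys k

nth-map : ∀ {A B : Set} (f : A → B) xs k → nth (map f xs) k ≡ Maybe.map f (nth xs k)
nth-map f []       k       = refl
nth-map f (_ ∷ xs) zero    = refl
nth-map f (_ ∷ xs) (suc k) = nth-map f xs k

∈⇒nth : ∀ {A : Set} {x : A} {xs} → x ∈ₗ xs → ∃ λ k → k < length xs × nth xs k ≡ just x
∈⇒nth (here refl) = 0 , s≤s z≤n , refl
∈⇒nth (there x∈xs) with ∈⇒nth x∈xs
... | k , k< , eq = suc k , s≤s k< , eq

elements : ∀ {m} → Subset m → List (Fin m)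
elements []            = []
elements (inside ∷ p)  = zero ∷ map suc (elements p)
elements (outside ∷ p) = map suc (elements p)

length-elements : ∀ {m} (p : Subset m) → length (elements p) ≡ ∣ p ∣
length-elements []            = refl
length-elements (inside ∷ p)  = cong suc (trans (length-map suc (elements p)) (length-elements p))
length-elements (outside ∷ p) = trans (length-map suc (elements p)) (length-elements p)

∈-elements : ∀ {m} {x : Fin m} {p} → x ∈ p → x ∈ₗ elements p
∈-elements here = here refl
∈-elements {p = inside ∷ p}  (there x∈p) = there (∈-map⁺ suc (∈-elements x∈p))
∈-elements {p = outside ∷ p} (there x∈p) = ∈-map⁺ suc (∈-elements x∈p)

countTrue : ∀ {m} → (Fin m → Bool) → ℕ
countTrue f = sum (map (λ u → if f u then 1 else 0) (allFin _))

countTrue-suc : ∀ {m} (f : Fin (suc m) → Bool) →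
                countTrue f ≡ (if f zero then 1 else 0) + countTrue (f ∘ suc)
countTrue-suc f = cong (λ xs → ind zero + sum xs)
  (trans (map-tabulate suc ind) (sym (map-tabulate (λ u → u) (ind ∘ suc))))
  where
  ind : Fin _ → ℕ
  ind u = if f u then 1 else 0

countTrue>0⇒∃ : ∀ {m} (f : Fin m → Bool) → 1 ≤ countTrue f → ∃ λ u → f u ≡ true
countTrue>0⇒∃ {zero}  f ()
countTrue>0⇒∃ {suc m} f pos with f zero in eq | subst (1 ≤_) (countTrue-suc f) pos
... | true  | _   = zero , eq
... | false | pos′ with countTrue>0⇒∃ (f ∘ suc) pos′
...   | u , fu = suc u , fu

countTrue≥1 : ∀ {m} (f : Fin m → Bool) u → f u ≡ true → 1 ≤ countTrue f
countTrue≥1 f zero    fu rewrite countTrue-suc f | fu = s≤s z≤n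
countTrue≥1 f (suc u) fu rewrite countTrue-suc f =
  ≤-trans (countTrue≥1 (f ∘ suc) u fu) (m≤n+m _ _)

countTrue≥2 : ∀ {m} (f : Fin m → Bool) u w → ¬ u ≡ w → f u ≡ true → f w ≡ true →
              2 ≤ countTrue f
countTrue≥2 f zero    zero    u≢w _  _  = ⊥-elim (u≢w refl)
countTrue≥2 f zero    (suc w) _   fu fw rewrite countTrue-suc f | fu =
  s≤s (countTrue≥1 (f ∘ suc) w fw)
countTrue≥2 f (suc u) zero    _   fu fw rewrite countTrue-suc f | fw =
  s≤s (countTrue≥1 (f ∘ suc) u fu)
countTrue≥2 f (suc u) (suc w) u≢w fu fw rewrite countTrue-suc f =
  ≤-trans (countTrue≥2 (f ∘ suc) u w (u≢w ∘ cong suc) fu fw) (m≤n+m _ _)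

module Burning (r : ℕ) (G : Graph) (s : List (Fin (n G))) where

  blue-suc⁺ : ∀ {j v} → blue r G s j v ≡ true → blue r G s (suc j) v ≡ true
  blue-suc⁺ p rewrite p = refl

  blue-mono : ∀ {i j v} → i ≤ j → blue r G s i v ≡ true → blue r G s j v ≡ true
  blue-mono i≤j = go (≤⇒≤′ i≤j)
    where
    go : ∀ {i j v} → i ≤′ j → blue r G s i v ≡ true → blue r G s j v ≡ true
    go ≤′-refl                     p = p
    go {j = suc j} (≤′-step i≤′j) p = blue-suc⁺ {j} (go i≤′j p)

  blue-source : ∀ {j v} → nth s j ≡ just v → blue r G s (suc j) v ≡ true
  blue-source {j} {v} sⱼ≡v rewrite sⱼ≡v | dec-true (v ≟ v) refl = ∨-zeroʳ (blue r G s j v)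

  blue-threshold : ∀ {j v} → r ≤ blueNbrs r G s j v → blue r G s (suc j) v ≡ true
  blue-threshold {j} {v} r≤ rewrite T-≡ .to (≤⇒≤ᵇ r≤) =
    trans (cong (blue r G s j v ∨_) (∨-zeroʳ _)) (∨-zeroʳ _)

  blue-suc⁻ : ∀ {j v} → blue r G s (suc j) v ≡ true →
              blue r G s j v ≡ true ⊎ nth s j ≡ just v ⊎ r ≤ blueNbrs r G s j v
  blue-suc⁻ {j} {v} p with blue r G s j v | nth s j | r ≤ᵇ blueNbrs r G s j v in thr
  ... | true  | _      | _    = inj₁ refl
  ... | false | _      | true = inj₂ (inj₂ (≤ᵇ⇒≤ r _ (T-≡ .from thr)))
  blue-suc⁻ () | false | nothing | false
  ... | false | just u | false with u ≟ v
  ...   | yes refl = inj₂ (inj₁ refl)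
  blue-suc⁻ () | false | just u | false | no _

  allBlue-mono : ∀ {i j} → i ≤ j → AllBlue r G s i → AllBlue r G s j
  allBlue-mono i≤j allᵢ v = blue-mono i≤j (allᵢ v)

  allBlue⇒rd≤ : ∀ t → AllBlue r G s t → ∃ λ t′ → t′ ≤ t × Rd r G s t′
  allBlue⇒rd≤ zero    all₀ = 0 , z≤n , all₀ , λ _ ()
  allBlue⇒rd≤ (suc t) all₁₊ₜ with all? (λ v → blue r G s t v Bool.≟ true)
  ... | yes allₜ with allBlue⇒rd≤ t allₜ
  ...   | t′ , t′≤t , rd = t′ , m≤n⇒m≤1+n t′≤t , rd
  allBlue⇒rd≤ (suc t) all₁₊ₜ | no ¬allₜ =
    suc t , ≤-refl , all₁₊ₜ , λ j j<1+t allⱼ → ¬allₜ (allBlue-mono (≤-pred j<1+t) allⱼ)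

burningNumber≤ : ∀ {r G b s t} → IsBurningNumber r G b → AllBlue r G s t → b ≤ t
burningNumber≤ {r} {G} {s = s} {t} (_ , minimal) allₜ with Burning.allBlue⇒rd≤ r G s t allₜ
... | t′ , t′≤t , rd = ≤-trans (minimal s t′ rd) t′≤t

module Removal (G : Graph) (D : Subset (n G)) where

  outsideᵇ : Fin (n G) → Bool
  outsideᵇ v = not (vlookup D v)

  embed : Fin (n (G ─ D)) → Fin (n G)
  embed = lookup (verticesOutside G D)

  embed-∉ : ∀ i → embed i ∉ D
  embed-∉ i i∈D =
    subst (T ∘ not) ([]=⇒lookup i∈D)
      (proj₂ (∈-filter⁻ (T? ∘ outsideᵇ) {xs = allFin _} (∈-lookup i)))

  ∈⊎embedded : ∀ v → v ∈ D ⊎ ∃ λ i → embed i ≡ v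
  ∈⊎embedded v with vlookup D v in v∈?D
  ... | inside  = inj₁ (lookup⇒[]= v D v∈?D)
  ... | outside = inj₂ (index v∈vs , sym (lookup-index v∈vs))
    where
    v∈vs : v ∈ₗ verticesOutside G D
    v∈vs = ∈-filter⁺ (T? ∘ outsideᵇ) (∈-allFin v) (subst (T ∘ not) (sym v∈?D) tt)

module Simulation (G : Graph) (D : Subset (n G)) (dom : Dominating G D)
                  (s : List (Fin (n (G ─ D)))) where
  open Removal G D

  sources : List (Fin (n G))
  sources = elements D ++ map embed s

  ℓ : ℕ
  ℓ = length (elements D)

  module G₂ = Burning 2 G sources
  module H₁ = Burning 1 (G ─ D) s

  D-blue : ∀ {v} → v ∈ D → blue 2 G sources ℓ v ≡ true
  D-blue v∈D with ∈⇒nth (∈-elements v∈D)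
  ... | k , k<ℓ , eq =
    G₂.blue-mono k<ℓ (G₂.blue-source (trans (nth-++ˡ (elements D) _ k<ℓ) eq))

  nth-sources : ∀ j {i} → nth s j ≡ just i → nth sources (ℓ + j) ≡ just (embed i)
  nth-sources j {i} sⱼ≡i = begin
    nth sources (ℓ + j)        ≡⟨ nth-++ʳ (elements D) _ j ⟩
    nth (map embed s) j        ≡⟨ nth-map embed s j ⟩
    Maybe.map embed (nth s j)  ≡⟨ cong (Maybe.map embed) sⱼ≡i ⟩
    just (embed i)             ∎
    where open ≡-Reasoning

  two-blue-neighbours : ∀ {j i u} → adj (G ─ D) i u ≡ true →
                        blue 2 G sources (ℓ + j) (embed u) ≡ true →
                        2 ≤ blueNbrs 2 G sources (ℓ + j) (embed i)
  two-blue-neighbours {j} {i} {u} iu u-blue with dom (embed i)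
  ... | inj₁ i∈D = ⊥-elim (embed-∉ i i∈D)
  ... | inj₂ (w , w∈D , iw) =
    countTrue≥2 _ (embed u) w (λ { refl → embed-∉ u w∈D })
      (cong₂ _∧_ iu u-blue) (cong₂ _∧_ iw (G₂.blue-mono (m≤m+n ℓ j) (D-blue w∈D)))

  simulate : ∀ j {i} → blue 1 (G ─ D) s j i ≡ true →
             blue 2 G sources (ℓ + j) (embed i) ≡ true
  simulate zero    ()
  simulate (suc j) {i} p rewrite +-suc ℓ j with H₁.blue-suc⁻ p
  ... | inj₁ old        = G₂.blue-suc⁺ {ℓ + j} (simulate j old)
  ... | inj₂ (inj₁ src) = G₂.blue-source (nth-sources j src)
  ... | inj₂ (inj₂ one)
    with countTrue>0⇒∃ (λ u → adj (G ─ D) i u ∧ blue 1 (G ─ D) s j u) one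
  ...   | u , iu∧u-blue =
    G₂.blue-threshold {ℓ + j}
      (two-blue-neighbours (∧-conicalˡ _ _ iu∧u-blue) (simulate j (∧-conicalʳ _ _ iu∧u-blue)))

  sources-allBlue : ∀ t → AllBlue 1 (G ─ D) s t → AllBlue 2 G sources (ℓ + t)
  sources-allBlue t allₜ v with ∈⊎embedded v
  ... | inj₁ v∈D        = G₂.blue-mono (m≤m+n ℓ t) (D-blue v∈D)
  ... | inj₂ (i , refl) = simulate t (allₜ i)

proposition2 : (G : Graph) → Connected G →
    (D : Subset (n G)) → Dominating G D →
    (γ b₂ b₁ : ℕ) → IsDominationNumber G γ → ∣ D ∣ ≡ γ →
    IsBurningNumber 2 G b₂ → IsBurningNumber 1 (G ─ D) b₁ →
    b₂ ≤ γ + b₁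
proposition2 G _ D dom _ b₂ b₁ _ ∣D∣≡γ b₂-burning ((s , allBlue₁ , _) , _) =
  subst (λ ℓ → b₂ ≤ ℓ + b₁) (trans (length-elements D) ∣D∣≡γ)
    (burningNumber≤ b₂-burning (Simulation.sources-allBlue G D dom s b₁ allBlue₁))
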